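{- Let $n$ be a positive integer and for each non-negative integer $m$ let $t_m=\frac{m(m+1)}{2}$ be the $m$-th triangular number. Then $$ \det\left(\binom{t_{i-1}}{j-1}\right)_{1\le i,j\le n} = \prod_{i=1}^{n-1}(2i-1)^{n-i}. $$ -}

module Defs where

open import Data.Nat as ℕ using (ℕ; zero; suc)
open import Data.Nat.Combinatorics using (_C_)
open import Data.Integer as ℤ using (ℤ; +_)
open import Data.Fin using (Fin; zero; suc; punchIn)

-- Square matrices over ℤ, indexed 0-based by Fin.
Matrix : ℕ → Set
Matrix n = Fin n → Fin n → ℤ

altSum : ∀ {n} → (Fin n → ℤ) → ℤ
altSum {zero}  f = + 0
altSum {suc n} f = f zero ℤ.- altSum (λ j → f (suc j))

det : ∀ {n} → Matrix n → ℤ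
det {zero}  M = + 1
det {suc n} M = altSum (λ j → M zero j ℤ.* det (λ r c → M (suc r) (punchIn j c)))

-- m-th triangular number t_m = m(m+1)/2, defined as 0 + 1 + ... + m.
tri : ℕ → ℕ
tri zero    = 0
tri (suc m) = suc m ℕ.+ tri m

prod1 : ℕ → (ℕ → ℕ) → ℕ
prod1 zero    f = 1
prod1 (suc k) f = prod1 k f ℕ.* f (suc k)

-- Write Dₐ(n) for the determinant of (C(tᵃᵢ, j))_{i,j<n}, where tᵃᵢ = (a+1) + ⋯ + (a+i), so that
-- the theorem is about D₀(n).  The first row is (1, 0, …, 0); dividing column j by j+1 and row i
-- by tᵃᵢ₊₁ turns the remaining entries, by (j+1)·C(t, j+1) = t·C(t−1, j), into C(a + tᵃ⁺¹ᵢ, j),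
-- and adding neighbouring columns (Pascal's rule) removes the shift a.  Hence
-- n!·Dₐ(n+1) = ∏ᵢ tᵃᵢ₊₁ · Dₐ₊₁(n), and as 2tᵃᵢ = i(i+2a+1), induction on n gives
-- 2^C(n,2)·Dₐ(n) = ∏_{m<n} ∏_{i<m} (2a+m+i+1), which for a = 0 is 2^C(n,2)·∏_{m<n} (2m−1)!!.

module Submission where

open import Defs

open import Function using (_∘_)
open import Data.Fin using (Fin; zero; suc; punchIn; inject₁; lift; toℕ; fromℕ<)
open import Data.Fin.Properties using (suc-injective; toℕ-inject₁; toℕ-fromℕ<; toℕ<n; toℕ-injective)
open import Data.Nat using (ℕ; zero; suc)
open import Relation.Binary.PropositionalEquality

open ≡-Reasoning

module Determinant where

  open import Data.Bool using (true; false; if_then_else_)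
  open import Data.Bool.Properties using (T-≡)
  open import Data.Nat using (_<_; _≤_; _<ᵇ_)
  open import Data.Nat.Properties using (<⇒<ᵇ; n<1+n; <⇒≤; ≤-refl)
  open import Data.Integer using (ℤ; +_; -[1+_]; _+_; _*_; -_; _-_)
  open import Data.Integer.Properties using (*-zeroʳ)
  open import Data.Integer.Solver using (module +-*-Solver)
  open import Function.Bundles using (Equivalence)
  open import Relation.Nullary using (contradiction)

  open +-*-Solver

  altSum-cong : ∀ {n} {f g : Fin n → ℤ} → f ≗ g → altSum f ≡ altSum g
  altSum-cong {zero}  f≗g = refl
  altSum-cong {suc n} f≗g = cong₂ _-_ (f≗g zero) (altSum-cong (f≗g ∘ suc))

  altSum-zero : ∀ {n} {f : Fin n → ℤ} → (∀ j → f j ≡ + 0) → altSum f ≡ + 0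
  altSum-zero {zero}  f≡0 = refl
  altSum-zero {suc n} f≡0 = cong₂ _-_ (f≡0 zero) (altSum-zero (f≡0 ∘ suc))

  altSum-+ : ∀ {n} (f g : Fin n → ℤ) → altSum (λ j → f j + g j) ≡ altSum f + altSum g
  altSum-+ {zero}  f g = refl
  altSum-+ {suc n} f g =
    trans (cong (_-_ (f zero + g zero)) (altSum-+ (f ∘ suc) (g ∘ suc)))
          (solve 4 (λ a b x y → a :+ b :- (x :+ y) := (a :- x) :+ (b :- y)) refl
                 (f zero) (g zero) (altSum (f ∘ suc)) (altSum (g ∘ suc)))

  altSum-minus : ∀ {n} (f g : Fin n → ℤ) → altSum (λ j → f j - g j) ≡ altSum f - altSum g
  altSum-minus {zero}  f g = refl
  altSum-minus {suc n} f g =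
    trans (cong (_-_ (f zero - g zero)) (altSum-minus (f ∘ suc) (g ∘ suc)))
          (solve 4 (λ a b x y → a :- b :- (x :- y) := (a :- x) :- (b :- y)) refl
                 (f zero) (g zero) (altSum (f ∘ suc)) (altSum (g ∘ suc)))

  altSum-*ˡ : ∀ {n} (c : ℤ) (f : Fin n → ℤ) → altSum (λ j → c * f j) ≡ c * altSum f
  altSum-*ˡ {zero}  c f = sym (*-zeroʳ c)
  altSum-*ˡ {suc n} c f =
    trans (cong (_-_ (c * f zero)) (altSum-*ˡ c (f ∘ suc)))
          (solve 3 (λ c a x → c :* a :- c :* x := c :* (a :- x)) refl c (f zero) (altSum (f ∘ suc)))

  altSum-comm : ∀ {m n} (f : Fin m → Fin n → ℤ) →
    altSum (λ i → altSum (f i)) ≡ altSum (λ j → altSum (λ i → f i j))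
  altSum-comm {zero} {n} f = sym (altSum-zero {n} (λ _ → refl))
  altSum-comm {suc m} f =
    trans (cong (_-_ (altSum (f zero))) (altSum-comm (f ∘ suc)))
          (sym (altSum-minus (f zero) (λ j → altSum (λ i → f (suc i) j))))

  altSum-interchange : ∀ {m n} (a : Fin m → ℤ) (b : Fin n → ℤ) (D : Fin m → Fin n → ℤ) →
    altSum (λ i → a i * altSum (λ j → b j * D i j)) ≡ altSum (λ j → b j * altSum (λ i → a i * D i j))
  altSum-interchange a b D = begin
      altSum (λ i → a i * altSum (λ j → b j * D i j))
    ≡⟨ altSum-cong (λ i → sym (altSum-*ˡ (a i) (λ j → b j * D i j))) ⟩
      altSum (λ i → altSum (λ j → a i * (b j * D i j)))
    ≡⟨ altSum-comm (λ i j → a i * (b j * D i j)) ⟩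
      altSum (λ j → altSum (λ i → a i * (b j * D i j)))
    ≡⟨ altSum-cong (λ j → trans (altSum-cong (λ i → swap (a i) (b j) (D i j)))
                                (altSum-*ˡ (b j) (λ i → a i * D i j))) ⟩
      altSum (λ j → b j * altSum (λ i → a i * D i j))
    ∎
    where
    swap : ∀ x y z → x * (y * z) ≡ y * (x * z)
    swap = solve 3 (λ x y z → x :* (y :* z) := y :* (x :* z)) refl

  minor : ∀ {n} → Matrix (suc n) → Fin (suc n) → Matrix n
  minor M j r c = M (suc r) (punchIn j c)

  det-cong : ∀ {n} {M N : Matrix n} → (∀ i j → M i j ≡ N i j) → det M ≡ det N
  det-cong {zero}  M≡N = refl
  det-cong {suc n} M≡N =
    altSum-cong (λ j → cong₂ _*_ (M≡N zero j) (det-cong (λ r c → M≡N (suc r) (punchIn j c))))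

  det-linear-row₀ : ∀ {n} (A B C : Matrix (suc n)) (c : ℤ) →
    (∀ j → A zero j ≡ B zero j + c * C zero j) →
    (∀ r j → A (suc r) j ≡ B (suc r) j) → (∀ r j → C (suc r) j ≡ B (suc r) j) →
    det A ≡ det B + c * det C
  det-linear-row₀ {n} A B C c row₀ rowsA rowsC = begin
      det A
    ≡⟨ altSum-cong term ⟩
      altSum (λ j → termB j + c * termC j)
    ≡⟨ altSum-+ termB (λ j → c * termC j) ⟩
      det B + altSum (λ j → c * termC j)
    ≡⟨ cong (_+_ (det B)) (altSum-*ˡ c termC) ⟩
      det B + c * det C
    ∎
    where
    termB termC : Fin (suc n) → ℤ
    termB j = B zero j * det (minor B j)
    termC j = C zero j * det (minor C j)
    term : ∀ j → A zero j * det (minor A j) ≡ termB j + c * termC j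
    term j = begin
        A zero j * det (minor A j)
      ≡⟨ cong₂ _*_ (row₀ j) (det-cong (λ r k → rowsA r (punchIn j k))) ⟩
        (B zero j + c * C zero j) * det (minor B j)
      ≡⟨ solve 4 (λ b c x d → (b :+ c :* x) :* d := b :* d :+ c :* (x :* d)) refl
               (B zero j) c (C zero j) (det (minor B j)) ⟩
        termB j + c * (C zero j * det (minor B j))
      ≡⟨ cong (λ d → termB j + c * (C zero j * d)) (det-cong (λ r k → sym (rowsC r (punchIn j k)))) ⟩
        termB j + c * termC j
      ∎

  Congruent : ∀ {m n} → ((Fin m → Fin n) → ℤ) → Set
  Congruent Q = ∀ {σ τ} → σ ≗ τ → Q σ ≡ Q τ

  -- Laplace expansion along the first two rows; Q stands for the determinant of the
  -- remaining rows restricted to the given columns.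
  laplace₂ : ∀ {n} (u v : Fin (suc (suc n)) → ℤ) → ((Fin n → Fin (suc (suc n))) → ℤ) → ℤ
  laplace₂ u v Q = altSum (λ j → u j * altSum (λ k → v (punchIn j k) * Q (punchIn j ∘ punchIn k)))

  module TwoRows {n} (Q : (Fin n → Fin (suc (suc n))) → ℤ) where

    tail : (Fin (suc n) → ℤ) → ℤ
    tail w = altSum (λ k → w k * Q (suc ∘ punchIn k))

    crossMinor : (Fin (suc (suc n)) → ℤ) → Fin (suc n) → ℤ
    crossMinor v j = altSum (λ k → v (suc (punchIn j k)) * Q (punchIn (suc j) ∘ punchIn (suc k)))

    cross : (u v : Fin (suc (suc n)) → ℤ) → ℤ
    cross u v = altSum (λ j → u (suc j) * crossMinor v j)

    laplace₂-split : ∀ u v →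
      laplace₂ u v Q ≡ u zero * tail (v ∘ suc) - (v zero * tail (u ∘ suc) - cross u v)
    laplace₂-split u v = cong (_-_ (u zero * tail (v ∘ suc))) (begin
        altSum (λ j → u (suc j) * (v zero * Q (suc ∘ punchIn j) - crossMinor v j))
      ≡⟨ altSum-cong (λ j → distrib (u (suc j)) (v zero) (Q (suc ∘ punchIn j)) (crossMinor v j)) ⟩
        altSum (λ j → v zero * uQ j - u (suc j) * crossMinor v j)
      ≡⟨ altSum-minus (λ j → v zero * uQ j) (λ j → u (suc j) * crossMinor v j) ⟩
        altSum (λ j → v zero * uQ j) - cross u v
      ≡⟨ cong (_- cross u v) (altSum-*ˡ (v zero) uQ) ⟩
        v zero * tail (u ∘ suc) - cross u v
      ∎)
      where
      uQ : Fin (suc n) → ℤ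
      uQ j = u (suc j) * Q (suc ∘ punchIn j)
      distrib : ∀ a b q i → a * (b * q - i) ≡ b * (a * q) - a * i
      distrib = solve 4 (λ a b q i → a :* (b :* q :- i) := b :* (a :* q) :- a :* i) refl

  -- Splitting off column 0, the cross term is again a two-row expansion, one size smaller.
  laplace₂-antisym : ∀ {n} (u v : Fin (suc (suc n)) → ℤ) (Q : (Fin n → Fin (suc (suc n))) → ℤ) →
    Congruent Q → laplace₂ u v Q ≡ - laplace₂ v u Q
  cross-antisym : ∀ {n} (Q : (Fin n → Fin (suc (suc n))) → ℤ) → Congruent Q →
    ∀ u v → TwoRows.cross Q u v ≡ - TwoRows.cross Q v u

  laplace₂-antisym u v Q Q-cong = begin
      laplace₂ u v Q
    ≡⟨ laplace₂-split u v ⟩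
      a - (b - cross u v)
    ≡⟨ cong (λ x → a - (b - x)) (cross-antisym Q Q-cong u v) ⟩
      a - (b - - cross v u)
    ≡⟨ solve 3 (λ a b x → a :- (b :- :- x) := :- (b :- (a :- x))) refl a b (cross v u) ⟩
      - (b - (a - cross v u))
    ≡⟨ cong -_ (laplace₂-split v u) ⟨
      - laplace₂ v u Q
    ∎
    where
    open TwoRows Q
    a b : ℤ
    a = u zero * tail (v ∘ suc)
    b = v zero * tail (u ∘ suc)

  cross-antisym {zero} Q _ u v = trans (vanishes u v) (sym (cong -_ (vanishes v u)))
    where
    vanishes : ∀ u v → TwoRows.cross Q u v ≡ + 0
    vanishes u v = altSum-zero (λ j → *-zeroʳ (u (suc j)))
  cross-antisym {suc n} Q Q-cong u v =
    trans (cross≡laplace₂ u v)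
          (trans (laplace₂-antisym (u ∘ suc) (v ∘ suc) (Q ∘ lift 1) Q∘lift-cong)
                 (cong -_ (sym (cross≡laplace₂ v u))))
    where
    Q∘lift-cong : Congruent (Q ∘ lift 1)
    Q∘lift-cong σ≗τ = Q-cong (λ { zero → refl ; (suc c) → cong suc (σ≗τ c) })
    cross≡laplace₂ : ∀ u v → TwoRows.cross Q u v ≡ laplace₂ (u ∘ suc) (v ∘ suc) (Q ∘ lift 1)
    cross≡laplace₂ u v = altSum-cong λ j → cong (u (suc j) *_) (altSum-cong λ k →
      cong (v (suc (punchIn j k)) *_)
           (Q-cong {punchIn (suc j) ∘ punchIn (suc k)} {lift 1 (punchIn j ∘ punchIn k)}
                   (λ { zero → refl ; (suc c) → refl })))

  i≡-i⇒i≡0 : ∀ {i} → i ≡ - i → i ≡ + 0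
  i≡-i⇒i≡0 {+ zero}    _  = refl
  i≡-i⇒i≡0 {+ suc n}   ()
  i≡-i⇒i≡0 { -[1+ n ]} ()

  laplace₂-diag : ∀ {n} (u : Fin (suc (suc n)) → ℤ) (Q : (Fin n → Fin (suc (suc n))) → ℤ) →
    Congruent Q → laplace₂ u u Q ≡ + 0
  laplace₂-diag u Q Q-cong = i≡-i⇒i≡0 (laplace₂-antisym u u Q Q-cong)

  det-addRow : ∀ {n} (M M′ : Matrix (suc n)) (k : Fin n) (c : ℤ) →
    (∀ j → M′ (suc k) j ≡ M (suc k) j + c * M (inject₁ k) j) →
    (∀ i → i ≢ suc k → ∀ j → M′ i j ≡ M i j) → det M′ ≡ det M
  det-addRow {suc n} M M′ zero c added others = begin
      det M′
    ≡⟨ altSum-cong (λ j → cong₂ _*_ (others zero (λ ()) j) (rowLinear j)) ⟩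
      altSum (λ j → M zero j * (det (minor M j) + c * det (minor M₀ j)))
    ≡⟨ altSum-cong (λ j → distrib (M zero j) (det (minor M j)) c (det (minor M₀ j))) ⟩
      altSum (λ j → M zero j * det (minor M j) + c * (M zero j * det (minor M₀ j)))
    ≡⟨ altSum-+ (λ j → M zero j * det (minor M j)) (λ j → c * (M zero j * det (minor M₀ j))) ⟩
      det M + altSum (λ j → c * (M zero j * det (minor M₀ j)))
    ≡⟨ cong (_+_ (det M)) (altSum-*ˡ c (λ j → M zero j * det (minor M₀ j))) ⟩
      det M + c * det M₀
    ≡⟨ cong (λ d → det M + c * d) (laplace₂-diag (M zero) rest rest-cong) ⟩
      det M + c * + 0
    ≡⟨ solve 2 (λ d c → d :+ c :* con (+ 0) := d) refl (det M) c ⟩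
      det M
    ∎
    where
    M₀ : Matrix (suc (suc n))
    M₀ zero          = M zero
    M₀ (suc zero)    = M zero
    M₀ (suc (suc r)) = M (suc (suc r))
    rest : (Fin n → Fin (suc (suc n))) → ℤ
    rest σ = det (λ r c → M (suc (suc r)) (σ c))
    rest-cong : Congruent rest
    rest-cong σ≗τ = det-cong (λ r c → cong (M (suc (suc r))) (σ≗τ c))
    rowLinear : ∀ j → det (minor M′ j) ≡ det (minor M j) + c * det (minor M₀ j)
    rowLinear j = det-linear-row₀ (minor M′ j) (minor M j) (minor M₀ j) c
      (λ k → added (punchIn j k))
      (λ r k → others (suc (suc r)) (λ ()) (punchIn j k))
      (λ r k → refl)
    distrib : ∀ m d c e → m * (d + c * e) ≡ m * d + c * (m * e)
    distrib = solve 4 (λ m d c e → m :* (d :+ c :* e) := m :* d :+ c :* (m :* e)) refl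
  det-addRow {suc n} M M′ (suc k) c added others =
    altSum-cong (λ j → cong₂ _*_ (others zero (λ ()) j)
      (det-addRow (minor M j) (minor M′ j) k c
         (λ c′ → added (punchIn j c′))
         (λ r r≢k c′ → others (suc r) (r≢k ∘ suc-injective) (punchIn j c′))))

  product : ∀ {n} → (Fin n → ℤ) → ℤ
  product {zero}  d = + 1
  product {suc n} d = d zero * product (d ∘ suc)

  det-scaleRows : ∀ {n} (d : Fin n → ℤ) (M : Matrix n) →
    det (λ i j → d i * M i j) ≡ product d * det M
  det-scaleRows {zero}  d M = refl
  det-scaleRows {suc n} d M = begin
      altSum (λ j → d zero * M zero j * det (λ r c → d (suc r) * minor M j r c))
    ≡⟨ altSum-cong (λ j → cong (d zero * M zero j *_) (det-scaleRows (d ∘ suc) (minor M j))) ⟩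
      altSum (λ j → d zero * M zero j * (product (d ∘ suc) * det (minor M j)))
    ≡⟨ altSum-cong (λ j → regroup (d zero) (M zero j) (product (d ∘ suc)) (det (minor M j))) ⟩
      altSum (λ j → product d * (M zero j * det (minor M j)))
    ≡⟨ altSum-*ˡ (product d) (λ j → M zero j * det (minor M j)) ⟩
      product d * det M
    ∎
    where
    regroup : ∀ a m p x → a * m * (p * x) ≡ a * p * (m * x)
    regroup = solve 4 (λ a m p x → a :* m :* (p :* x) := a :* p :* (m :* x)) refl

  det-column₀ : ∀ {n} (M : Matrix (suc n)) →
    altSum (λ i → M i zero * det (λ r c → M (punchIn i r) (suc c))) ≡ det M
  det-column₀ {zero}  M = refl
  det-column₀ {suc n} M = cong (_-_ (M zero zero * det (minor M zero))) (begin
      altSum (λ i → M (suc i) zero * altSum (λ j → M zero (suc j) * D i j))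
    ≡⟨ altSum-interchange (λ i → M (suc i) zero) (λ j → M zero (suc j)) D ⟩
      altSum (λ j → M zero (suc j) * altSum (λ i → M (suc i) zero * D i j))
    ≡⟨ altSum-cong (λ j → cong (M zero (suc j) *_) (det-column₀ (minor M (suc j)))) ⟩
      altSum (λ j → M zero (suc j) * det (minor M (suc j)))
    ∎)
    where
    D : Fin (suc n) → Fin (suc n) → ℤ
    D i j = det (λ r c → M (suc (punchIn i r)) (suc (punchIn j c)))

  det-transpose : ∀ {n} (M : Matrix n) → det (λ i j → M j i) ≡ det M
  det-transpose {zero}  M = refl
  det-transpose {suc n} M =
    trans (altSum-cong (λ i → cong (M i zero *_) (det-transpose (λ r c → M (punchIn i r) (suc c)))))
          (det-column₀ M)

  det-addColumn : ∀ {n} (M M′ : Matrix (suc n)) (k : Fin n) (c : ℤ) →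
    (∀ i → M′ i (suc k) ≡ M i (suc k) + c * M i (inject₁ k)) →
    (∀ j → j ≢ suc k → ∀ i → M′ i j ≡ M i j) → det M′ ≡ det M
  det-addColumn M M′ k c added others = begin
    det M′                    ≡⟨ det-transpose M′ ⟨
    det (λ i j → M′ j i)      ≡⟨ det-addRow (λ i j → M j i) (λ i j → M′ j i) k c added others ⟩
    det (λ i j → M j i)       ≡⟨ det-transpose M ⟩
    det M                     ∎

  det-scaleColumns : ∀ {n} (d : Fin n → ℤ) (M : Matrix n) →
    det (λ i j → d j * M i j) ≡ product d * det M
  det-scaleColumns d M = begin
    det (λ i j → d j * M i j)           ≡⟨ det-transpose (λ i j → d j * M i j) ⟨
    det (λ i j → d i * M j i)           ≡⟨ det-scaleRows d (λ i j → M j i) ⟩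
    product d * det (λ i j → M j i)     ≡⟨ cong (product d *_) (det-transpose M) ⟩
    product d * det M                   ∎

  det-unitRow₀ : ∀ {n} (M : Matrix (suc n)) → M zero zero ≡ + 1 → (∀ j → M zero (suc j) ≡ + 0) →
    det M ≡ det (minor M zero)
  det-unitRow₀ M one zeros = begin
      M zero zero * det (minor M zero) - altSum (λ j → M zero (suc j) * det (minor M (suc j)))
    ≡⟨ cong₂ (λ a b → a * det (minor M zero) - b) one
             (altSum-zero (λ j → cong (_* det (minor M (suc j))) (zeros j))) ⟩
      + 1 * det (minor M zero) - + 0
    ≡⟨ solve 1 (λ x → con (+ 1) :* x :- con (+ 0) := x) refl (det (minor M zero)) ⟩
      det (minor M zero)
    ∎

  <ᵇ-true : ∀ {m n} → m < n → (m <ᵇ n) ≡ true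
  <ᵇ-true m<n = Equivalence.to T-≡ (<⇒<ᵇ m<n)

  <ᵇ-irrefl : ∀ n → (n <ᵇ n) ≡ false
  <ᵇ-irrefl zero    = refl
  <ᵇ-irrefl (suc n) = <ᵇ-irrefl n

  <ᵇ-suc : ∀ {m n} → m ≢ n → (m <ᵇ suc n) ≡ (m <ᵇ n)
  <ᵇ-suc {zero}  {zero}  m≢n = contradiction refl m≢n
  <ᵇ-suc {zero}  {suc n} m≢n = refl
  <ᵇ-suc {suc m} {zero}  m≢n = refl
  <ᵇ-suc {suc m} {suc n} m≢n = <ᵇ-suc (m≢n ∘ cong suc)

  addPrevColumns : ∀ {n} → Matrix (suc n) → Matrix (suc n)
  addPrevColumns M i zero    = M i zero
  addPrevColumns M i (suc j) = M i (suc j) + M i (inject₁ j)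

  -- Adding to every column its left neighbour is the composite of n elementary column operations,
  -- performed from right to left: partiallyAdded k still has its first k columns untouched.
  module _ {n} (M : Matrix (suc n)) where

    partiallyAdded : ℕ → Matrix (suc n)
    partiallyAdded k i j = if toℕ j <ᵇ k then M i j else addPrevColumns M i j

    private
      step : ∀ (k : Fin n) → det (partiallyAdded (suc (suc (toℕ k)))) ≡ det (partiallyAdded (suc (toℕ k)))
      step k = det-addColumn (partiallyAdded (suc t)) (partiallyAdded (suc (suc t))) k (- + 1)
                             added others
        where
        t : ℕ
        t = toℕ k
        added : ∀ i → partiallyAdded (suc (suc t)) i (suc k)
                    ≡ partiallyAdded (suc t) i (suc k) + - + 1 * partiallyAdded (suc t) i (inject₁ k)
        added i rewrite <ᵇ-true (n<1+n t) | <ᵇ-irrefl t | toℕ-inject₁ k | <ᵇ-true (n<1+n t) =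
          solve 2 (λ a b → a := (a :+ b) :+ :- con (+ 1) :* b) refl (M i (suc k)) (M i (inject₁ k))
        others : ∀ j → j ≢ suc k → ∀ i → partiallyAdded (suc (suc t)) i j ≡ partiallyAdded (suc t) i j
        others j j≢k+1 i = cong (λ b → if b then M i j else addPrevColumns M i j)
                                (<ᵇ-suc (j≢k+1 ∘ toℕ-injective))

      steps : ∀ m → m ≤ n → det (partiallyAdded (suc m)) ≡ det (partiallyAdded 0)
      steps zero    _   = det-cong {M = partiallyAdded 1} {N = partiallyAdded 0}
                                   (λ { i zero → refl ; i (suc j) → refl })
      steps (suc m) m<n = trans (subst (λ t → det (partiallyAdded (suc (suc t))) ≡ det (partiallyAdded (suc t)))
                                       (toℕ-fromℕ< m<n) (step (fromℕ< m<n)))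
                                (steps m (<⇒≤ m<n))

    det-addPrevColumns : det (addPrevColumns M) ≡ det M
    det-addPrevColumns = begin
      det (addPrevColumns M)          ≡⟨ steps n ≤-refl ⟨
      det (partiallyAdded (suc n))    ≡⟨ det-cong untouched ⟩
      det M                           ∎
      where
      untouched : ∀ i j → partiallyAdded (suc n) i j ≡ M i j
      untouched i j = cong (λ b → if b then M i j else addPrevColumns M i j) (<ᵇ-true (toℕ<n j))

open Determinant

open import Data.Nat using (_+_; _*_; _^_; _∸_; _≤_; NonZero)
open import Data.Nat.Properties
open import Data.Nat.Combinatorics using (_C_; nC1≡n; nCk+nC[k+1]≡[n+1]C[k+1])
open import Data.Nat.Solver using (module +-*-Solver)
open import Data.Integer as ℤ using (ℤ; +_)
import Data.Integer.Properties as ℤ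
open import Algebra.Properties.CommutativeSemigroup ℤ.*-commutativeSemigroup using (x∙yz≈y∙xz)

open +-*-Solver

C-absorb : ∀ w c → suc c * (suc w C suc c) ≡ suc w * (w C c)
C-absorb w       zero    =
  trans (*-identityˡ (suc w C 1)) (trans (nC1≡n (suc w)) (sym (*-identityʳ (suc w))))
C-absorb zero    (suc c) = *-zeroʳ (suc (suc c))
C-absorb (suc w) (suc c) = begin
    suc (suc c) * (suc (suc w) C suc (suc c))
  ≡⟨ cong (suc (suc c) *_) (nCk+nC[k+1]≡[n+1]C[k+1] (suc w) (suc c)) ⟨
    suc (suc c) * (b₁ + b₂)
  ≡⟨ solve 3 (λ c x y → (con 2 :+ c) :* (x :+ y) := x :+ (con 1 :+ c) :* x :+ (con 2 :+ c) :* y)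
           refl c b₁ b₂ ⟩
    b₁ + suc c * b₁ + suc (suc c) * b₂
  ≡⟨ cong₂ (λ x y → b₁ + x + y) (C-absorb w c) (C-absorb w (suc c)) ⟩
    b₁ + suc w * (w C c) + suc w * (w C suc c)
  ≡⟨ solve 4 (λ b w x y → b :+ w :* x :+ w :* y := b :+ w :* (x :+ y))
           refl b₁ (suc w) (w C c) (w C suc c) ⟩
    b₁ + suc w * (w C c + w C suc c)
  ≡⟨ cong (λ x → b₁ + suc w * x) (nCk+nC[k+1]≡[n+1]C[k+1] w c) ⟩
    suc (suc w) * b₁
  ∎
  where
  b₁ b₂ : ℕ
  b₁ = suc w C suc c
  b₂ = suc w C suc (suc c)

binomials : ∀ n → (ℕ → ℕ) → Matrix n
binomials n y i j = + (y (toℕ i) C toℕ j)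

det-binomials-suc : ∀ n y → det (binomials n (suc ∘ y)) ≡ det (binomials n y)
det-binomials-suc zero    y = refl
det-binomials-suc (suc n) y = trans (det-cong pascal) (det-addPrevColumns (binomials (suc n) y))
  where
  pascal : ∀ i j → binomials (suc n) (suc ∘ y) i j ≡ addPrevColumns (binomials (suc n) y) i j
  pascal i zero    = refl
  pascal i (suc j) rewrite toℕ-inject₁ j = pascalℤ (y (toℕ i)) (toℕ j)
    where
    pascalℤ : ∀ m k → + (suc m C suc k) ≡ + (m C suc k) ℤ.+ + (m C k)
    pascalℤ m k = begin
      + (suc m C suc k)           ≡⟨ cong +_ (nCk+nC[k+1]≡[n+1]C[k+1] m k) ⟨
      + (m C k + m C suc k)       ≡⟨ cong +_ (+-comm (m C k) (m C suc k)) ⟩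
      + (m C suc k + m C k)       ≡⟨ ℤ.pos-+ (m C suc k) (m C k) ⟩
      + (m C suc k) ℤ.+ + (m C k) ∎

det-binomials-shift : ∀ s n y → det (binomials n (λ i → s + y i)) ≡ det (binomials n y)
det-binomials-shift zero    n y = refl
det-binomials-shift (suc s) n y =
  trans (det-binomials-suc n (λ i → s + y i)) (det-binomials-shift s n y)

∏< : ℕ → (ℕ → ℕ) → ℕ
∏< zero    f = 1
∏< (suc n) f = f 0 * ∏< n (f ∘ suc)

∏<-cong : ∀ n {f g : ℕ → ℕ} → (∀ i → f i ≡ g i) → ∏< n f ≡ ∏< n g
∏<-cong zero    f≡g = refl
∏<-cong (suc n) f≡g = cong₂ _*_ (f≡g 0) (∏<-cong n (f≡g ∘ suc))

∏<-* : ∀ n (f g : ℕ → ℕ) → ∏< n (λ i → f i * g i) ≡ ∏< n f * ∏< n g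
∏<-* zero    f g = refl
∏<-* (suc n) f g = trans (cong (f 0 * g 0 *_) (∏<-* n (f ∘ suc) (g ∘ suc)))
  (solve 4 (λ a b x y → a :* b :* (x :* y) := a :* x :* (b :* y)) refl
           (f 0) (g 0) (∏< n (f ∘ suc)) (∏< n (g ∘ suc)))

∏<-last : ∀ n (f : ℕ → ℕ) → ∏< (suc n) f ≡ ∏< n f * f n
∏<-last zero    f = trans (*-identityʳ (f 0)) (sym (*-identityˡ (f 0)))
∏<-last (suc n) f = trans (cong (f 0 *_) (∏<-last n (f ∘ suc))) (sym (*-assoc (f 0) _ (f (suc n))))

∏<-const : ∀ n m → ∏< n (λ _ → m) ≡ m ^ n
∏<-const zero    m = refl
∏<-const (suc n) m = cong (m *_) (∏<-const n m)

∏<-nonZero : ∀ n (f : ℕ → ℕ) → (∀ i → NonZero (f i)) → NonZero (∏< n f)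
∏<-nonZero zero    f f≢0 = _
∏<-nonZero (suc n) f f≢0 = m*n≢0 (f 0) _ {{f≢0 0}} {{∏<-nonZero n (f ∘ suc) (f≢0 ∘ suc)}}

product-toℕ : ∀ n (f : ℕ → ℕ) → product {n} (λ i → + f (toℕ i)) ≡ + ∏< n f
product-toℕ zero    f = refl
product-toℕ (suc n) f =
  trans (cong (+ f 0 ℤ.*_) (product-toℕ n (f ∘ suc))) (sym (ℤ.pos-* (f 0) (∏< n (f ∘ suc))))

triFrom : ℕ → ℕ → ℕ
triFrom a zero    = 0
triFrom a (suc i) = suc (a + i) + triFrom a i

tri≡triFrom0 : ∀ m → tri m ≡ triFrom 0 m
tri≡triFrom0 zero    = refl
tri≡triFrom0 (suc m) = cong (_+_ (suc m)) (tri≡triFrom0 m)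

triFrom-shift : ∀ a i → triFrom (suc a) i ≡ i + triFrom a i
triFrom-shift a zero    = refl
triFrom-shift a (suc i) = trans (cong (_+_ (suc (suc a + i))) (triFrom-shift a i))
  (solve 3 (λ a i t → con 2 :+ a :+ i :+ (i :+ t) := con 1 :+ i :+ (con 1 :+ a :+ i :+ t))
           refl a i (triFrom a i))

triFrom-suc : ∀ a i → triFrom a (suc i) ≡ suc (a + triFrom (suc a) i)
triFrom-suc a i = cong suc (trans (+-assoc a i (triFrom a i)) (cong (_+_ a) (sym (triFrom-shift a i))))

2*triFrom : ∀ a i → 2 * triFrom a i ≡ i * (i + 2 * a + 1)
2*triFrom a zero    = refl
2*triFrom a (suc i) = trans (*-distribˡ-+ 2 (suc (a + i)) (triFrom a i))
  (trans (cong (_+_ (2 * suc (a + i))) (2*triFrom a i))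
    (solve 2 (λ a i → con 2 :* (con 1 :+ (a :+ i)) :+ i :* (i :+ con 2 :* a :+ con 1)
                   := (con 1 :+ i) :* (con 1 :+ i :+ con 2 :* a :+ con 1)) refl a i))

detTri : ℕ → ℕ → ℤ
detTri n a = det (binomials n (triFrom a))

detTri-recurrence : ∀ n a →
  + ∏< n suc ℤ.* detTri (suc n) a ≡ + ∏< n (triFrom a ∘ suc) ℤ.* detTri n (suc a)
detTri-recurrence n a = begin
    + ∏< n suc ℤ.* detTri (suc n) a
  ≡⟨ cong₂ ℤ._*_ (sym (product-toℕ n suc))
                 (det-unitRow₀ (binomials (suc n) (triFrom a)) refl (λ _ → refl)) ⟩
    product {n} (λ c → + suc (toℕ c)) ℤ.* det (λ r c → + (T r C suc (toℕ c)))
  ≡⟨ det-scaleColumns (λ c → + suc (toℕ c)) (λ r c → + (T r C suc (toℕ c))) ⟨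
    det (λ r c → + suc (toℕ c) ℤ.* + (T r C suc (toℕ c)))
  ≡⟨ det-cong absorb ⟩
    det (λ r c → + T r ℤ.* + ((a + triFrom (suc a) (toℕ r)) C toℕ c))
  ≡⟨ det-scaleRows (λ r → + T r) (binomials n (λ i → a + triFrom (suc a) i)) ⟩
    product (λ r → + T r) ℤ.* det (binomials n (λ i → a + triFrom (suc a) i))
  ≡⟨ cong₂ ℤ._*_ (product-toℕ n (triFrom a ∘ suc)) (det-binomials-shift a n (triFrom (suc a))) ⟩
    + ∏< n (triFrom a ∘ suc) ℤ.* detTri n (suc a)
  ∎
  where
  T : Fin n → ℕ
  T r = triFrom a (suc (toℕ r))
  absorb : ∀ r c → + suc (toℕ c) ℤ.* + (T r C suc (toℕ c))
                 ≡ + T r ℤ.* + ((a + triFrom (suc a) (toℕ r)) C toℕ c)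
  absorb r c = begin
      + suc (toℕ c) ℤ.* + (T r C suc (toℕ c))
    ≡⟨ ℤ.pos-* (suc (toℕ c)) _ ⟨
      + (suc (toℕ c) * (T r C suc (toℕ c)))
    ≡⟨ cong (λ t → + (suc (toℕ c) * (t C suc (toℕ c)))) (triFrom-suc a (toℕ r)) ⟩
      + (suc (toℕ c) * (suc w C suc (toℕ c)))
    ≡⟨ cong +_ (C-absorb w (toℕ c)) ⟩
      + (suc w * (w C toℕ c))
    ≡⟨ cong (λ t → + (t * (w C toℕ c))) (triFrom-suc a (toℕ r)) ⟨
      + (T r * (w C toℕ c))
    ≡⟨ ℤ.pos-* (T r) _ ⟩
      + T r ℤ.* + (w C toℕ c)
    ∎
    where
    w : ℕ
    w = a + triFrom (suc a) (toℕ r)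

∏<-triFrom : ∀ n a → 2 ^ n * ∏< n (triFrom a ∘ suc) ≡ ∏< n suc * ∏< n (λ r → 2 + 2 * a + r)
∏<-triFrom n a = begin
    2 ^ n * ∏< n (triFrom a ∘ suc)
  ≡⟨ cong (_* ∏< n (triFrom a ∘ suc)) (∏<-const n 2) ⟨
    ∏< n (λ _ → 2) * ∏< n (triFrom a ∘ suc)
  ≡⟨ ∏<-* n (λ _ → 2) (triFrom a ∘ suc) ⟨
    ∏< n (λ r → 2 * triFrom a (suc r))
  ≡⟨ ∏<-cong n (λ r → trans (2*triFrom a (suc r)) (regroup a r)) ⟩
    ∏< n (λ r → suc r * (2 + 2 * a + r))
  ≡⟨ ∏<-* n suc (λ r → 2 + 2 * a + r) ⟩
    ∏< n suc * ∏< n (λ r → 2 + 2 * a + r)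
  ∎
  where
  regroup : ∀ a r → suc r * (suc r + 2 * a + 1) ≡ suc r * (2 + 2 * a + r)
  regroup = solve 2 (λ a r → (con 1 :+ r) :* (con 1 :+ r :+ con 2 :* a :+ con 1)
                          := (con 1 :+ r) :* (con 2 :+ con 2 :* a :+ r)) refl

detTri-suc : ∀ n a →
  + (2 ^ n) ℤ.* detTri (suc n) a ≡ + ∏< n (λ r → 2 + 2 * a + r) ℤ.* detTri n (suc a)
detTri-suc n a = ℤ.*-cancelˡ-≡ (+ ∏< n suc) _ _ {{∏<-nonZero n suc _}} (begin
    + ∏< n suc ℤ.* (+ (2 ^ n) ℤ.* detTri (suc n) a)
  ≡⟨ x∙yz≈y∙xz (+ ∏< n suc) (+ (2 ^ n)) (detTri (suc n) a) ⟩
    + (2 ^ n) ℤ.* (+ ∏< n suc ℤ.* detTri (suc n) a)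
  ≡⟨ cong (+ (2 ^ n) ℤ.*_) (detTri-recurrence n a) ⟩
    + (2 ^ n) ℤ.* (+ ∏< n (triFrom a ∘ suc) ℤ.* detTri n (suc a))
  ≡⟨ ℤ.*-assoc (+ (2 ^ n)) _ _ ⟨
    + (2 ^ n) ℤ.* + ∏< n (triFrom a ∘ suc) ℤ.* detTri n (suc a)
  ≡⟨ cong (ℤ._* detTri n (suc a)) (trans (sym (ℤ.pos-* (2 ^ n) _))
          (trans (cong +_ (∏<-triFrom n a)) (ℤ.pos-* (∏< n suc) _))) ⟩
    + ∏< n suc ℤ.* + ∏< n (λ r → 2 + 2 * a + r) ℤ.* detTri n (suc a)
  ≡⟨ ℤ.*-assoc (+ ∏< n suc) _ _ ⟩
    + ∏< n suc ℤ.* (+ ∏< n (λ r → 2 + 2 * a + r) ℤ.* detTri n (suc a))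
  ∎)

rowFactor : ℕ → ℕ → ℕ
rowFactor m a = ∏< m (λ i → suc (2 * a + m + i))

rowFactor-suc : ∀ m a → rowFactor (suc m) a ≡ (2 + 2 * a + m) * rowFactor m (suc a)
rowFactor-suc m a = cong₂ _*_
  (solve 2 (λ a m → con 1 :+ (con 2 :* a :+ (con 1 :+ m) :+ con 0) := con 2 :+ con 2 :* a :+ m)
           refl a m)
  (∏<-cong m (λ i → solve 3 (λ a m i → con 1 :+ (con 2 :* a :+ (con 1 :+ m) :+ (con 1 :+ i))
                                   := con 1 :+ (con 2 :* (con 1 :+ a) :+ m :+ i)) refl a m i))

∏<-rowFactor-suc : ∀ n a →
  ∏< (suc n) (λ m → rowFactor m a) ≡ ∏< n (λ r → 2 + 2 * a + r) * ∏< n (λ m → rowFactor m (suc a))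
∏<-rowFactor-suc n a =
  trans (*-identityˡ (∏< n (λ m → rowFactor (suc m) a)))
        (trans (∏<-cong n (λ m → rowFactor-suc m a))
               (∏<-* n (λ r → 2 + 2 * a + r) (λ m → rowFactor m (suc a))))

C2-suc : ∀ n → suc n C 2 ≡ n + n C 2
C2-suc n = trans (sym (nCk+nC[k+1]≡[n+1]C[k+1] n 1)) (cong (_+ n C 2) (nC1≡n n))

detTri-closed : ∀ n a → + (2 ^ (n C 2)) ℤ.* detTri n a ≡ + ∏< n (λ m → rowFactor m a)
detTri-closed zero    a = refl
detTri-closed (suc n) a = begin
    + (2 ^ (suc n C 2)) ℤ.* detTri (suc n) a
  ≡⟨ cong (λ e → + (2 ^ e) ℤ.* detTri (suc n) a) (C2-suc n) ⟩
    + (2 ^ (n + n C 2)) ℤ.* detTri (suc n) a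
  ≡⟨ cong (ℤ._* detTri (suc n) a)
          (trans (cong +_ (^-distribˡ-+-* 2 n (n C 2))) (ℤ.pos-* (2 ^ n) (2 ^ (n C 2)))) ⟩
    + (2 ^ n) ℤ.* + (2 ^ (n C 2)) ℤ.* detTri (suc n) a
  ≡⟨ cong (ℤ._* detTri (suc n) a) (ℤ.*-comm (+ (2 ^ n)) _) ⟩
    + (2 ^ (n C 2)) ℤ.* + (2 ^ n) ℤ.* detTri (suc n) a
  ≡⟨ ℤ.*-assoc (+ (2 ^ (n C 2))) _ _ ⟩
    + (2 ^ (n C 2)) ℤ.* (+ (2 ^ n) ℤ.* detTri (suc n) a)
  ≡⟨ cong (+ (2 ^ (n C 2)) ℤ.*_) (detTri-suc n a) ⟩
    + (2 ^ (n C 2)) ℤ.* (+ H ℤ.* detTri n (suc a))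
  ≡⟨ x∙yz≈y∙xz (+ (2 ^ (n C 2))) (+ H) (detTri n (suc a)) ⟩
    + H ℤ.* (+ (2 ^ (n C 2)) ℤ.* detTri n (suc a))
  ≡⟨ cong (+ H ℤ.*_) (detTri-closed n (suc a)) ⟩
    + H ℤ.* + ∏< n (λ m → rowFactor m (suc a))
  ≡⟨ trans (sym (ℤ.pos-* H _)) (cong +_ (sym (∏<-rowFactor-suc n a))) ⟩
    + ∏< (suc n) (λ m → rowFactor m a)
  ∎
  where
  H : ℕ
  H = ∏< n (λ r → 2 + 2 * a + r)

oddFactorial : ℕ → ℕ
oddFactorial m = prod1 m (λ i → 2 * i ∸ 1)

oddFactorial-suc : ∀ m → oddFactorial (suc m) ≡ oddFactorial m * suc (2 * m)
oddFactorial-suc m = cong (oddFactorial m *_) (+-suc m (m + 0))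

rowFactor-zero : ∀ m → rowFactor m 0 ≡ 2 ^ m * oddFactorial m
rowFactor-zero zero    = refl
rowFactor-zero (suc m) = *-cancelˡ-≡ _ _ (suc m) (begin
    suc m * ∏< (suc m) (λ i → suc (suc m + i))
  ≡⟨ cong (suc m *_) (∏<-last m (λ i → suc (suc m + i))) ⟩
    suc m * (∏< m (λ i → suc (suc m + i)) * suc (suc m + m))
  ≡⟨ *-assoc (suc m) (∏< m (λ i → suc (suc m + i))) (suc (suc m + m)) ⟨
    suc m * ∏< m (λ i → suc (suc m + i)) * suc (suc m + m)
  ≡⟨ cong (_* suc (suc m + m)) shiftedRow ⟩
    2 ^ m * oddFactorial m * suc (m + m) * suc (suc m + m)
  ≡⟨ solve 3 (λ m p d → p :* d :* (con 1 :+ (m :+ m)) :* (con 1 :+ (con 1 :+ m :+ m))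
                      := (con 1 :+ m) :* (con 2 :* p :* (d :* (con 1 :+ con 2 :* m)))) refl
           m (2 ^ m) (oddFactorial m) ⟩
    suc m * (2 ^ suc m * (oddFactorial m * suc (2 * m)))
  ≡⟨ cong (λ x → suc m * (2 ^ suc m * x)) (oddFactorial-suc m) ⟨
    suc m * (2 ^ suc m * oddFactorial (suc m))
  ∎)
  where
  shiftedRow : suc m * ∏< m (λ i → suc (suc m + i)) ≡ 2 ^ m * oddFactorial m * suc (m + m)
  shiftedRow = begin
      suc m * ∏< m (λ i → suc (suc m + i))
    ≡⟨ cong₂ _*_ (cong suc (+-identityʳ m)) (∏<-cong m (λ i → cong suc (+-suc m i))) ⟨
      ∏< (suc m) (λ i → suc (m + i))
    ≡⟨ ∏<-last m (λ i → suc (m + i)) ⟩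
      ∏< m (λ i → suc (m + i)) * suc (m + m)
    ≡⟨ cong (_* suc (m + m)) (rowFactor-zero m) ⟩
      2 ^ m * oddFactorial m * suc (m + m)
    ∎

∏<-2^ : ∀ n → ∏< n (2 ^_) ≡ 2 ^ (n C 2)
∏<-2^ zero    = refl
∏<-2^ (suc n) = begin
  ∏< (suc n) (2 ^_)          ≡⟨ ∏<-last n (2 ^_) ⟩
  ∏< n (2 ^_) * 2 ^ n        ≡⟨ cong (_* 2 ^ n) (∏<-2^ n) ⟩
  2 ^ (n C 2) * 2 ^ n        ≡⟨ *-comm (2 ^ (n C 2)) _ ⟩
  2 ^ n * 2 ^ (n C 2)        ≡⟨ ^-distribˡ-+-* 2 n (n C 2) ⟨
  2 ^ (n + n C 2)            ≡⟨ cong (2 ^_) (C2-suc n) ⟨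
  2 ^ (suc n C 2)            ∎

detTri-zero : ∀ n → detTri n 0 ≡ + ∏< n oddFactorial
detTri-zero n = ℤ.*-cancelˡ-≡ (+ (2 ^ (n C 2))) _ _ {{m^n≢0 2 (n C 2)}} (begin
    + (2 ^ (n C 2)) ℤ.* detTri n 0
  ≡⟨ detTri-closed n 0 ⟩
    + ∏< n (λ m → rowFactor m 0)
  ≡⟨ cong +_ (∏<-cong n rowFactor-zero) ⟩
    + ∏< n (λ m → 2 ^ m * oddFactorial m)
  ≡⟨ cong +_ (∏<-* n (2 ^_) oddFactorial) ⟩
    + (∏< n (2 ^_) * ∏< n oddFactorial)
  ≡⟨ cong (λ p → + (p * ∏< n oddFactorial)) (∏<-2^ n) ⟩
    + (2 ^ (n C 2) * ∏< n oddFactorial)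
  ≡⟨ ℤ.pos-* (2 ^ (n C 2)) _ ⟩
    + (2 ^ (n C 2)) ℤ.* + ∏< n oddFactorial
  ∎)

prod1-cong : ∀ k {f g : ℕ → ℕ} → (∀ i → i ≤ k → f i ≡ g i) → prod1 k f ≡ prod1 k g
prod1-cong zero    f≡g = refl
prod1-cong (suc k) f≡g =
  cong₂ _*_ (prod1-cong k (λ i i≤k → f≡g i (m≤n⇒m≤1+n i≤k))) (f≡g (suc k) ≤-refl)

prod1-* : ∀ k (f g : ℕ → ℕ) → prod1 k (λ i → f i * g i) ≡ prod1 k f * prod1 k g
prod1-* zero    f g = refl
prod1-* (suc k) f g = trans (cong (_* (f (suc k) * g (suc k))) (prod1-* k f g))
  (solve 4 (λ a b x y → a :* b :* (x :* y) := a :* x :* (b :* y)) refl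
           (prod1 k f) (prod1 k g) (f (suc k)) (g (suc k)))

prod1-oddPowers : ∀ k → prod1 k (λ i → (2 * i ∸ 1) ^ (suc k ∸ i)) ≡ ∏< (suc k) oddFactorial
prod1-oddPowers zero    = refl
prod1-oddPowers (suc k) = begin
    prod1 k (λ i → odd i ^ (suc (suc k) ∸ i)) * odd (suc k) ^ (suc (suc k) ∸ suc k)
  ≡⟨ cong₂ _*_ (prod1-cong k (λ i i≤k → cong (odd i ^_) (+-∸-assoc 1 (m≤n⇒m≤1+n i≤k))))
               (cong (odd (suc k) ^_) (m+n∸n≡m 1 k)) ⟩
    prod1 k (λ i → odd i * odd i ^ (suc k ∸ i)) * odd (suc k) ^ 1
  ≡⟨ cong (_* odd (suc k) ^ 1) (trans (prod1-cong k (λ i _ → *-comm (odd i) _))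
                                       (prod1-* k (λ i → odd i ^ (suc k ∸ i)) odd)) ⟩
    prod1 k (λ i → odd i ^ (suc k ∸ i)) * oddFactorial k * odd (suc k) ^ 1
  ≡⟨ cong (λ p → p * oddFactorial k * odd (suc k) ^ 1) (prod1-oddPowers k) ⟩
    ∏< (suc k) oddFactorial * oddFactorial k * odd (suc k) ^ 1
  ≡⟨ solve 3 (λ p d x → p :* d :* (x :* con 1) := p :* (d :* x)) refl
           (∏< (suc k) oddFactorial) (oddFactorial k) (odd (suc k)) ⟩
    ∏< (suc k) oddFactorial * oddFactorial (suc k)
  ≡⟨ ∏<-last (suc k) oddFactorial ⟨
    ∏< (suc (suc k)) oddFactorial
  ∎
  where
  odd : ℕ → ℕ
  odd i = 2 * i ∸ 1

proposition2 : (k : ℕ) → let n = suc k in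
    det {n} (λ i j → + (tri (toℕ i) C toℕ j))
      ≡ + prod1 (n ∸ 1) (λ i → (2 * i ∸ 1) ^ (n ∸ i))
proposition2 k = begin
    det {suc k} (λ i j → + (tri (toℕ i) C toℕ j))
  ≡⟨ det-cong {suc k} (λ i j → cong (λ t → + (t C toℕ j)) (tri≡triFrom0 (toℕ i))) ⟩
    detTri (suc k) 0
  ≡⟨ detTri-zero (suc k) ⟩
    + ∏< (suc k) oddFactorial
  ≡⟨ cong +_ (prod1-oddPowers k) ⟨
    + prod1 k (λ i → (2 * i ∸ 1) ^ (suc k ∸ i))
  ∎
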